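{- Let $R_1$ and $R_2$ be finite commutative principal ideal rings with unity and $R=R_1\times R_2$ such that $\mathrm{diam}(\Gamma(R_1))=\mathrm{diam}(\Gamma(R_2))=1$. Then $\overline{\Gamma(R)}$ is not a divisor graph.
   Context: For a commutative ring $S$ with unity, $Z(S)$ is its set of zero divisors. The zero divisor graph $\Gamma(S)$ has vertex set $Z(S)\setminus\{0\}$, distinct $a,b$ adjacent iff $ab=0$; its complement $\overline{\Gamma(S)}$ has the same vertex set, distinct $a,b$ adjacent iff $ab\neq0$. The diameter $\mathrm{diam}$ of a graph is the maximum distance between two of its vertices. A graph $G$ is a divisor graph if it is isomorphic to the graph $G(S)$ on some set $S$ of positive integers in which distinct $i,j$ are adjacent iff $i\mid j$ or $j\mid i$. -}

module Defs where

open import Level using (Level; _⊔_; suc)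
open import Algebra.Bundles using (CommutativeRing)
open import Data.Nat using (ℕ; zero; suc; NonZero; _<_)
open import Data.Nat.Divisibility using (_∣_)
open import Data.Fin using (Fin)
open import Data.Product using (Σ; ∃; ∃-syntax; _×_; _,_; proj₁)
open import Data.Sum using (_⊎_)
open import Relation.Nullary using (¬_)
open import Relation.Binary.Core using (Rel)
open import Relation.Binary.PropositionalEquality using (_≡_)
open import Relation.Unary using (Pred)
open import Function.Bundles using (_⇔_)

record Graph (a ℓ : Level) : Set (Level.suc (a ⊔ ℓ)) where
  field
    V   : Set a
    _≃_ : Rel V ℓ
    Adj : Rel V ℓ

module _ {a ℓ} (G : Graph a ℓ) where
  open Graph G

  Walk : ℕ → V → V → Set (a ⊔ ℓ)
  Walk zero    u v = Level.Lift (a ⊔ ℓ) (u ≃ v)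
  Walk (suc n) u v = ∃[ w ] (Adj u w × Walk n w v)

  Dist : V → V → ℕ → Set (a ⊔ ℓ)
  Dist u v d = Walk d u v × (∀ m → m < d → ¬ Walk m u v)

  HasDiameter : ℕ → Set (a ⊔ ℓ)
  HasDiameter d =
    (∀ u v → ∃[ e ] (Dist u v e × e Data.Nat.≤ d)) × (∃[ u ] ∃[ v ] Dist u v d)

  -- G is isomorphic to the divisor graph G(S) of a set S of positive
  -- integers; S is the image of the (injective) vertex labelling f.
  IsDivisorGraph : Set (a ⊔ ℓ)
  IsDivisorGraph =
    Σ (V → ℕ) λ f →
      (∀ v → NonZero (f v)) ×
      (∀ u v → u ≃ v → f u ≡ f v) ×
      (∀ u v → f u ≡ f v → u ≃ v) ×
      (∀ u v → Adj u v ⇔ ((¬ f u ≡ f v) × (f u ∣ f v ⊎ f v ∣ f u)))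

module _ {c ℓ} (R : CommutativeRing c ℓ) where
  open CommutativeRing R

  IsFinite : Set (c ⊔ ℓ)
  IsFinite = ∃[ n ] Σ (Fin n → Carrier) λ e → ∀ x → ∃[ i ] (x ≈ e i)

  record IsIdeal (I : Pred Carrier (c ⊔ ℓ)) : Set (c ⊔ ℓ) where
    field
      resp  : ∀ {x y} → x ≈ y → I x → I y
      zero∈ : I 0#
      +-closed : ∀ {x y} → I x → I y → I (x + y)
      *-closed : ∀ r {x} → I x → I (r * x)

  IsPrincipal : Pred Carrier (c ⊔ ℓ) → Set (c ⊔ ℓ)
  IsPrincipal I = ∃[ a ] (∀ x → I x ⇔ (∃[ r ] (x ≈ r * a)))

  IsPIR : Set (Level.suc (c ⊔ ℓ))
  IsPIR = ∀ (I : Pred Carrier (c ⊔ ℓ)) → IsIdeal I → IsPrincipal I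

  IsZeroDivisor : Carrier → Set (c ⊔ ℓ)
  IsZeroDivisor x = ∃[ y ] ((¬ y ≈ 0#) × (x * y ≈ 0#))

  ZDVertex : Set (c ⊔ ℓ)
  ZDVertex = Σ Carrier λ x → IsZeroDivisor x × (¬ x ≈ 0#)

  Γ : Graph (c ⊔ ℓ) ℓ
  Γ = record
    { V   = ZDVertex
    ; _≃_ = λ u v → proj₁ u ≈ proj₁ v
    ; Adj = λ u v → (¬ proj₁ u ≈ proj₁ v) × (proj₁ u * proj₁ v ≈ 0#)
    }

  Γᶜ : Graph (c ⊔ ℓ) ℓ
  Γᶜ = record
    { V   = ZDVertex
    ; _≃_ = λ u v → proj₁ u ≈ proj₁ v
    ; Adj = λ u v → (¬ proj₁ u ≈ proj₁ v) × (¬ proj₁ u * proj₁ v ≈ 0#)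
    }

-- A divisor graph is a comparability graph: orienting each edge along
-- divisibility of the labels, or against it, gives a transitive orientation.
-- In a transitive orientation an induced path u — v — w forces u → v and w → v
-- to point the same way at v.  Taking nonzero a, b ∈ R₁ with ab = 0 and
-- c, d ∈ R₂ with cd = 0 (they exist because diam Γ(Rᵢ) = 1), seven vertices of
-- the complement of Γ(R₁ × R₂) are linked by a cycle of such forcings that
-- turns the edge (0,1) — (0,c) around, so neither orientation of it is possible.
module Submission where

open import Defs
open import Algebra.Bundles using (CommutativeRing)
open import Algebra.Construct.DirectProduct using (commutativeRing)
open import Level using (_⊔_; 0ℓ)
open import Data.Empty using (⊥-elim)
open import Data.Nat using (ℕ)
open import Data.Nat.Divisibility using (_∣_; ∣-trans; ∣-antisym)
open import Data.Product using (_×_; _,_; proj₁; proj₂)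
open import Data.Sum using (_⊎_; inj₁; inj₂; swap)
open import Function using (_∘_; flip)
open import Function.Bundles using (Equivalence; _⇔_)
open import Relation.Binary.Core using (Rel)
open import Relation.Nullary using (¬_)
open import Relation.Binary.PropositionalEquality using (_≡_)

module _ {a ℓ} (G : Graph a ℓ) where
  open Graph G

  record IsTransitiveOrientation {r} (_⇝_ : Rel V r) : Set (a ⊔ ℓ ⊔ r) where
    field
      orient    : ∀ {u v} → Adj u v → u ⇝ v ⊎ v ⇝ u
      adj-trans : ∀ {u v w} → u ⇝ v → v ⇝ w → ¬ u ≃ w → Adj u w
      antisym   : ∀ {u v} → u ⇝ v → v ⇝ u → u ≃ v

    forced : ∀ {u v w} → Adj v w → ¬ u ≃ w → ¬ Adj u w → u ⇝ v → w ⇝ v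
    forced v—w u≄w u≁w u⇝v with orient v—w
    ... | inj₁ v⇝w = ⊥-elim (u≁w (adj-trans u⇝v v⇝w u≄w))
    ... | inj₂ w⇝v = w⇝v

module DivisorLabelling {a ℓ} {G : Graph a ℓ} (isDivisorGraph : IsDivisorGraph G) where
  open Graph G

  private
    f : V → ℕ
    f = proj₁ isDivisorGraph

    f-injective : ∀ u v → f u ≡ f v → u ≃ v
    f-injective = proj₁ (proj₂ (proj₂ (proj₂ isDivisorGraph)))

    adj⇔ : ∀ u v → Adj u v ⇔ (¬ f u ≡ f v × (f u ∣ f v ⊎ f v ∣ f u))
    adj⇔ = proj₂ (proj₂ (proj₂ (proj₂ isDivisorGraph)))

    f-distinct : ∀ {u v} → ¬ u ≃ v → ¬ f u ≡ f v
    f-distinct {u} {v} u≄v = u≄v ∘ f-injective u v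

  _⊑_ : Rel V 0ℓ
  u ⊑ v = f u ∣ f v

  ⊑-isTransitiveOrientation : IsTransitiveOrientation G _⊑_
  ⊑-isTransitiveOrientation = record
    { orient    = λ {u} {v} u—v → proj₂ (Equivalence.to (adj⇔ u v) u—v)
    ; adj-trans = λ {u} {v} {w} u⊑v v⊑w u≄w →
        Equivalence.from (adj⇔ u w) (f-distinct u≄w , inj₁ (∣-trans u⊑v v⊑w))
    ; antisym   = λ {u} {v} u⊑v v⊑u → f-injective u v (∣-antisym u⊑v v⊑u)
    }

  ⊒-isTransitiveOrientation : IsTransitiveOrientation G (flip _⊑_)
  ⊒-isTransitiveOrientation = record
    { orient    = swap ∘ orient
    ; adj-trans = λ {u} {v} {w} v⊑u w⊑v u≄w →
        Equivalence.from (adj⇔ u w) (f-distinct u≄w , inj₂ (∣-trans w⊑v v⊑u))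
    ; antisym   = flip antisym
    }
    where open IsTransitiveOrientation ⊑-isTransitiveOrientation

module _ {c ℓ} (R : CommutativeRing c ℓ) where
  open CommutativeRing R

  zdVertex : ∀ x y → ¬ y ≈ 0# → x * y ≈ 0# → ¬ x ≈ 0# → ZDVertex R
  zdVertex x y y≉0 xy≈0 x≉0 = x , (y , y≉0 , xy≈0) , x≉0

  record AnnihilatingPair : Set (c ⊔ ℓ) where
    field
      a b  : Carrier
      a≉0  : ¬ a ≈ 0#
      b≉0  : ¬ b ≈ 0#
      a≉b  : ¬ a ≈ b
      ab≈0 : a * b ≈ 0#

    ba≈0 : b * a ≈ 0#
    ba≈0 = trans (*-comm b a) ab≈0

    1≉0 : ¬ 1# ≈ 0#
    1≉0 1≈0 = a≉0 (trans (sym (*-identityʳ a)) (trans (*-congˡ 1≈0) (zeroʳ a)))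

    a≉1 : ¬ a ≈ 1#
    a≉1 a≈1 = b≉0 (trans (sym (*-identityˡ b)) (trans (*-congʳ (sym a≈1)) ab≈0))

    b≉1 : ¬ b ≈ 1#
    b≉1 b≈1 = a≉0 (trans (sym (*-identityʳ a)) (trans (*-congˡ (sym b≈1)) ab≈0))

  diameter-one⇒annihilatingPair : HasDiameter (Γ R) 1 → AnnihilatingPair
  diameter-one⇒annihilatingPair (_ , u , _ , (w , (u≉w , uw≈0) , _) , _) = record
    { a = proj₁ u ; b = proj₁ w ; a≉0 = proj₂ (proj₂ u) ; b≉0 = proj₂ (proj₂ w)
    ; a≉b = u≉w ; ab≈0 = uw≈0 }

  1*≉0 : ∀ {x} → ¬ x ≈ 0# → ¬ 1# * x ≈ 0#
  1*≉0 x≉0 = x≉0 ∘ trans (sym (*-identityˡ _))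

  *1≉0 : ∀ {x} → ¬ x ≈ 0# → ¬ x * 1# ≈ 0#
  *1≉0 x≉0 = x≉0 ∘ trans (sym (*-identityʳ _))

module ProductComplement {c₁ ℓ₁ c₂ ℓ₂}
  {R₁ : CommutativeRing c₁ ℓ₁} {R₂ : CommutativeRing c₂ ℓ₂}
  (P₁ : AnnihilatingPair R₁) (P₂ : AnnihilatingPair R₂) where

  private
    module R₁ = CommutativeRing R₁
    module R₂ = CommutativeRing R₂
    module P₁ = AnnihilatingPair P₁
    module P₂ = AnnihilatingPair P₂
    R : CommutativeRing (c₁ ⊔ c₂) (ℓ₁ ⊔ ℓ₂)
    R = commutativeRing R₁ R₂
    open CommutativeRing R using (_≈_; _*_; 0#)
    open P₁ using (a; b)
    open P₂ renaming (a to c; b to d)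

  open Graph (Γᶜ R)

  v01 v0c v10 v1d va0 vb1 vbd : ZDVertex R
  v01 = zdVertex R (R₁.0# , R₂.1#) (R₁.1# , R₂.0#) (P₁.1≉0 ∘ proj₁) (R₁.zeroˡ _ , R₂.zeroʳ _) (P₂.1≉0 ∘ proj₂)
  v0c = zdVertex R (R₁.0# , c) (R₁.1# , R₂.0#) (P₁.1≉0 ∘ proj₁) (R₁.zeroˡ _ , R₂.zeroʳ _) (P₂.a≉0 ∘ proj₂)
  v10 = zdVertex R (R₁.1# , R₂.0#) (R₁.0# , R₂.1#) (P₂.1≉0 ∘ proj₂) (R₁.zeroʳ _ , R₂.zeroˡ _) (P₁.1≉0 ∘ proj₁)
  v1d = zdVertex R (R₁.1# , d) (R₁.0# , c) (P₂.a≉0 ∘ proj₂) (R₁.zeroʳ _ , P₂.ba≈0) (P₁.1≉0 ∘ proj₁)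
  va0 = zdVertex R (a , R₂.0#) (R₁.0# , R₂.1#) (P₂.1≉0 ∘ proj₂) (R₁.zeroʳ _ , R₂.zeroˡ _) (P₁.a≉0 ∘ proj₁)
  vb1 = zdVertex R (b , R₂.1#) (a , R₂.0#) (P₁.a≉0 ∘ proj₁) (P₁.ba≈0 , R₂.zeroʳ _) (P₁.b≉0 ∘ proj₁)
  vbd = zdVertex R (b , d) (a , c) (P₁.a≉0 ∘ proj₁) (P₁.ba≈0 , P₂.ba≈0) (P₁.b≉0 ∘ proj₁)

  record _⟂_ (u w : ZDVertex R) : Set (ℓ₁ ⊔ ℓ₂) where
    constructor _,_
    field
      distinct     : ¬ u ≃ w
      annihilating : proj₁ u * proj₁ w ≈ 0#

  v01—v0c : Adj v01 v0c
  v01—v0c = P₂.a≉1 ∘ R₂.sym ∘ proj₂ , 1*≉0 R₂ P₂.a≉0 ∘ proj₂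
  v01—v1d : Adj v01 v1d
  v01—v1d = P₁.1≉0 ∘ R₁.sym ∘ proj₁ , 1*≉0 R₂ P₂.b≉0 ∘ proj₂
  v1d—va0 : Adj v1d va0
  v1d—va0 = P₁.a≉1 ∘ R₁.sym ∘ proj₁ , 1*≉0 R₁ P₁.a≉0 ∘ proj₁
  v1d—vb1 : Adj v1d vb1
  v1d—vb1 = P₁.b≉1 ∘ R₁.sym ∘ proj₁ , 1*≉0 R₁ P₁.b≉0 ∘ proj₁
  vb1—v0c : Adj vb1 v0c
  vb1—v0c = P₁.b≉0 ∘ proj₁ , 1*≉0 R₂ P₂.a≉0 ∘ proj₂
  vb1—v10 : Adj vb1 v10
  vb1—v10 = P₂.1≉0 ∘ proj₂ , *1≉0 R₁ P₁.b≉0 ∘ proj₁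
  v10—va0 : Adj v10 va0
  v10—va0 = P₁.a≉1 ∘ R₁.sym ∘ proj₁ , 1*≉0 R₁ P₁.a≉0 ∘ proj₁
  v10—vbd : Adj v10 vbd
  v10—vbd = P₁.b≉1 ∘ R₁.sym ∘ proj₁ , 1*≉0 R₁ P₁.b≉0 ∘ proj₁
  vbd—v01 : Adj vbd v01
  vbd—v01 = P₁.b≉0 ∘ proj₁ , *1≉0 R₂ P₂.b≉0 ∘ proj₂

  v0c⟂v1d : v0c ⟂ v1d
  v0c⟂v1d = P₁.1≉0 ∘ R₁.sym ∘ proj₁ , R₁.zeroˡ _ , P₂.ab≈0
  v01⟂va0 : v01 ⟂ va0
  v01⟂va0 = P₂.1≉0 ∘ proj₂ , R₁.zeroˡ _ , R₂.zeroʳ _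
  va0⟂vb1 : va0 ⟂ vb1
  va0⟂vb1 = P₂.1≉0 ∘ R₂.sym ∘ proj₂ , P₁.ab≈0 , R₂.zeroˡ _
  v1d⟂v0c : v1d ⟂ v0c
  v1d⟂v0c = P₁.1≉0 ∘ proj₁ , R₁.zeroʳ _ , P₂.ba≈0
  v0c⟂v10 : v0c ⟂ v10
  v0c⟂v10 = P₁.1≉0 ∘ R₁.sym ∘ proj₁ , R₁.zeroˡ _ , R₂.zeroʳ _
  vb1⟂va0 : vb1 ⟂ va0
  vb1⟂va0 = P₂.1≉0 ∘ proj₂ , P₁.ba≈0 , R₂.zeroʳ _
  va0⟂vbd : va0 ⟂ vbd
  va0⟂vbd = P₁.a≉b ∘ proj₁ , P₁.ab≈0 , R₂.zeroˡ _
  v10⟂v01 : v10 ⟂ v01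
  v10⟂v01 = P₁.1≉0 ∘ proj₁ , R₁.zeroʳ _ , R₂.zeroˡ _
  vbd⟂v0c : vbd ⟂ v0c
  vbd⟂v0c = P₁.b≉0 ∘ proj₁ , R₁.zeroʳ _ , P₂.ba≈0

  module _ {r} {_⇝_ : Rel (ZDVertex R) r}
    (⇝-isTO : IsTransitiveOrientation (Γᶜ R) _⇝_)
    (⇜-isTO : IsTransitiveOrientation (Γᶜ R) (flip _⇝_)) where

    private
      into : ∀ {u v w} → Adj v w → u ⟂ w → u ⇝ v → w ⇝ v
      into v—w (u≄w , uw≈0) =
        IsTransitiveOrientation.forced ⇝-isTO v—w u≄w λ u—w → proj₂ u—w uw≈0

      outOf : ∀ {u v w} → Adj v w → u ⟂ w → v ⇝ u → v ⇝ w
      outOf v—w (u≄w , uw≈0) =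
        IsTransitiveOrientation.forced ⇜-isTO v—w u≄w λ u—w → proj₂ u—w uw≈0

    v01⇝v0c⇒v0c⇝v01 : v01 ⇝ v0c → v0c ⇝ v01
    v01⇝v0c⇒v0c⇝v01 =
        into    v01—v0c vbd⟂v0c
      ∘ outOf   vbd—v01 v10⟂v01
      ∘ into    v10—vbd va0⟂vbd
      ∘ into    v10—va0 vb1⟂va0
      ∘ outOf   vb1—v10 v0c⟂v10
      ∘ outOf   vb1—v0c v1d⟂v0c
      ∘ into    v1d—vb1 va0⟂vb1
      ∘ into    v1d—va0 v01⟂va0
      ∘ outOf   v01—v1d v0c⟂v1d

  no-opposite-transitive-orientations :
    ∀ {r} {_⇝_ : Rel (ZDVertex R) r} →
    IsTransitiveOrientation (Γᶜ R) _⇝_ → ¬ IsTransitiveOrientation (Γᶜ R) (flip _⇝_)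
  no-opposite-transitive-orientations ⇝-isTO ⇜-isTO
    with IsTransitiveOrientation.orient ⇝-isTO v01—v0c
  ... | inj₁ v01⇝v0c = proj₁ v01—v0c (antisym v01⇝v0c (v01⇝v0c⇒v0c⇝v01 ⇝-isTO ⇜-isTO v01⇝v0c))
    where open IsTransitiveOrientation ⇝-isTO
  ... | inj₂ v0c⇝v01 = proj₁ v01—v0c (antisym v0c⇝v01 (v01⇝v0c⇒v0c⇝v01 ⇜-isTO ⇝-isTO v0c⇝v01))
    where open IsTransitiveOrientation ⇜-isTO

theorem2p4 : ∀ {c₁ ℓ₁ c₂ ℓ₂} (R₁ : CommutativeRing c₁ ℓ₁) (R₂ : CommutativeRing c₂ ℓ₂) →
    IsFinite R₁ → IsPIR R₁ → IsFinite R₂ → IsPIR R₂ →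
    HasDiameter (Γ R₁) 1 → HasDiameter (Γ R₂) 1 →
    ¬ IsDivisorGraph (Γᶜ (commutativeRing R₁ R₂))
theorem2p4 R₁ R₂ _ _ _ _ diam₁ diam₂ isDivisorGraph =
  no-opposite-transitive-orientations
    ⊑-isTransitiveOrientation ⊒-isTransitiveOrientation
  where
    open ProductComplement (diameter-one⇒annihilatingPair R₁ diam₁)
                           (diameter-one⇒annihilatingPair R₂ diam₂)
    open DivisorLabelling isDivisorGraph
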